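{- Let $A[1..n]$ be an array of distinct numbers, $k\ge1$, and $1\le j\le n$. Then the structure $S_k(j)$ can be reconstructed from the answers to the queries $\textsc{RTopK}(A[\ell..j])$, $1\le\ell\le j$.
   Context: $\textsc{RTopK}(A[i..j])$ returns the ordered list of indices of the $k$ largest elements of $A[i..j]$ (all of them if fewer than $k$), sorted so that the $m$-th returned index holds the $m$-th largest value. For $1\le \ell\le j$, let $d_j(\ell)$ be the number of positions $\ell'\in(\ell,j]$ with $A[\ell']>A[\ell]$. The structure $S_k(j)$ is the array of length $j$ with $S_k(j,\ell)=\min(d_j(\ell),k)$. -}

module Defs where

open import Data.Nat using (ℕ; zero; suc; _+_; _∸_; _≤_; _⊓_)
import Data.Nat.Properties as ℕP
open import Data.Integer using (ℤ; _<_)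
open import Data.Integer.Properties using (_<?_)
open import Data.List using (List; map; upTo; filter; concatMap; length)
open import Relation.Binary.PropositionalEquality using (_≡_)

-- An array A[1..n] is modelled as a function ℕ → ℤ; only positions 1..n matter.
Array : Set
Array = ℕ → ℤ

Distinct : ℕ → Array → Set
Distinct n A = ∀ p q → 1 ≤ p → p ≤ n → 1 ≤ q → q ≤ n → A p ≡ A q → p ≡ q

range : ℕ → ℕ → List ℕ
range i j = map (i +_) (upTo (suc j ∸ i))

rankIn : Array → ℕ → ℕ → ℕ → ℕ
rankIn A i j p = length (filter (λ q → A p <? A q) (range i j))

-- RTopK(A[i..j]): indices of the k largest elements of A[i..j], in decreasing
-- order of value (the m-th returned index holds the m-th largest value, i.e.
-- has exactly m-1 larger elements in the range). All of them if fewer than k.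
RTopK : ℕ → Array → ℕ → ℕ → List ℕ
RTopK k A i j =
  concatMap (λ m → filter (λ p → rankIn A i j p ℕP.≟ m) (range i j)) (upTo k)

d : Array → ℕ → ℕ → ℕ
d A j ℓ = length (filter (λ q → A ℓ <? A q) (range (suc ℓ) j))

S : ℕ → ℕ → Array → List ℕ
S k j A = map (λ ℓ → d A j ℓ ⊓ k) (range 1 j)

queries : ℕ → ℕ → Array → List (List ℕ)
queries k j A = map (λ ℓ → RTopK k A ℓ j) (range 1 j)

-- Write r_ℓ for the rank function of the window A[ℓ..j] (number of larger
-- elements in the window). RTopK(A[ℓ..j]) lists the window by increasing rank, rank
-- values 0, 1, …, k − 1 in turn. Since ℓ is the first position of the window,
-- r_ℓ(ℓ) = d_j(ℓ); since the values are distinct, r_ℓ is injective on the window and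
-- exactly r_ℓ(ℓ) positions have a smaller rank. Hence ℓ occurs in the answer iff
-- d_j(ℓ) < k, and then exactly at index d_j(ℓ): the index of ℓ in the answer, or k if
-- ℓ is absent, is min(d_j(ℓ), k).
module Submission where

open import Data.Empty using (⊥-elim)
open import Data.Integer.Base using () renaming (_<_ to _<ℤ_)
import Data.Integer.Properties as ℤ
open import Data.List.Base
  using (List; []; _∷_; _++_; [_]; _∷ʳ_; map; zipWith; filter; concatMap; length; upTo)
open import Data.List.Properties
  using (concatMap-++; ++-identityʳ; upTo-∷ʳ; length-++; filter-none; filter-reject;
         map-∘; map-cong; map-applyUpTo; map-cong-local)
open import Data.List.Membership.Propositional using (_∈_; _∉_; find)
open import Data.List.Membership.Propositional.Properties
  using (∈-map⁻; ∈-applyUpTo⁻; ∈-concatMap⁻; ∈-filter⁺; ∈-filter⁻)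
open import Data.List.Relation.Unary.All as All using ()
open import Data.List.Relation.Unary.Any using (here; there)
open import Data.Maybe.Base as Maybe using (Maybe; just; nothing; fromMaybe)
open import Data.Maybe.Properties using (map-id) renaming (map-∘ to map-∘ᵐ)
open import Data.Nat.Base using (ℕ; zero; suc; _+_; _∸_; _⊓_; _≤_; _<_; z≤n; s≤s)
open import Data.Nat.Properties
  using (_≟_; _<?_; ≤-reflexive; ≤-trans; ≤-antisym; ≤-pred; <-irrefl; <-asym; <⇒≤;
         <⇒≢; <⇒≱; ≮⇒≥; n≮0; m≤n⇒m≤1+n; m<n⇒m<1+n; m<1+n⇒m<n∨m≡n; m≤m+n; +-comm; +-suc;
         +-identityʳ; +-∸-assoc; m∸n≢0⇒n<m; m≤o∸n⇒m+n≤o; m≤n⇒m⊓n≡m; m≥n⇒m⊓n≡n)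
open import Data.Product.Base using (Σ; _×_; _,_)
open import Data.Sum.Base using (inj₁; inj₂; [_,_]′)
open import Function.Base using (id)
open import Level using (Level)
open import Relation.Binary.Definitions using (DecidableEquality; tri<; tri≈; tri>)
open import Relation.Binary.PropositionalEquality
  using (_≡_; refl; sym; trans; cong; cong₂; subst; module ≡-Reasoning)
open import Relation.Nullary using (¬_; yes; no; contradiction)
open import Relation.Unary using (Pred; Decidable; _≐_; _∪_; _⊥_)

open import Defs

open ≡-Reasoning

private
  variable
    a ℓ₁ ℓ₂ ℓ₃ : Level
    X : Set a

count : {P : Pred X ℓ₁} → Decidable P → List X → ℕ
count P? xs = length (filter P? xs)

module _ {P : Pred X ℓ₁} {Q : Pred X ℓ₂} (P? : Decidable P) (Q? : Decidable Q) where

  count-mono : ∀ {xs} → (∀ {x} → x ∈ xs → P x → Q x) → count P? xs ≤ count Q? xs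
  count-mono {[]}     _   = z≤n
  count-mono {y ∷ ys} P⊆Q with P? y | Q? y
  ... | yes _  | yes _  = s≤s (count-mono (λ x∈ → P⊆Q (there x∈)))
  ... | yes py | no ¬qy = contradiction (P⊆Q (here refl) py) ¬qy
  ... | no _   | yes _  = m≤n⇒m≤1+n (count-mono (λ x∈ → P⊆Q (there x∈)))
  ... | no _   | no _   = count-mono (λ x∈ → P⊆Q (there x∈))

  count-strict-mono : ∀ {xs z} → (∀ {x} → x ∈ xs → P x → Q x) →
                      z ∈ xs → ¬ P z → Q z → count P? xs < count Q? xs
  count-strict-mono {y ∷ ys} P⊆Q (here refl) ¬pz qz with P? y | Q? y
  ... | yes py | _      = contradiction py ¬pz
  ... | no _   | yes _  = s≤s (count-mono (λ x∈ → P⊆Q (there x∈)))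
  ... | no _   | no ¬qy = contradiction qz ¬qy
  count-strict-mono {y ∷ ys} P⊆Q (there z∈) ¬pz qz with P? y | Q? y
  ... | yes _  | yes _  = s≤s (count-strict-mono (λ x∈ → P⊆Q (there x∈)) z∈ ¬pz qz)
  ... | yes py | no ¬qy = contradiction (P⊆Q (here refl) py) ¬qy
  ... | no _   | yes _  = m<n⇒m<1+n (count-strict-mono (λ x∈ → P⊆Q (there x∈)) z∈ ¬pz qz)
  ... | no _   | no _   = count-strict-mono (λ x∈ → P⊆Q (there x∈)) z∈ ¬pz qz

count-cong : ∀ {P : Pred X ℓ₁} {Q : Pred X ℓ₂} (P? : Decidable P) (Q? : Decidable Q) {xs} →
             (∀ {x} → x ∈ xs → P x → Q x) → (∀ {x} → x ∈ xs → Q x → P x) →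
             count P? xs ≡ count Q? xs
count-cong P? Q? P⊆Q Q⊆P = ≤-antisym (count-mono P? Q? P⊆Q) (count-mono Q? P? Q⊆P)

count-disjoint-∪ : ∀ {P : Pred X ℓ₁} {Q : Pred X ℓ₂} {R : Pred X ℓ₃}
                   (P? : Decidable P) (Q? : Decidable Q) (R? : Decidable R) →
                   R ≐ P ∪ Q → P ⊥ Q → ∀ xs → count R? xs ≡ count P? xs + count Q? xs
count-disjoint-∪ P? Q? R? R≐P∪Q P⊥Q [] = refl
count-disjoint-∪ P? Q? R? R≐P∪Q@(R⊆P∪Q , P∪Q⊆R) P⊥Q (y ∷ ys)
  with ih ← count-disjoint-∪ P? Q? R? R≐P∪Q P⊥Q ys | R? y | P? y | Q? y
... | yes _  | yes py | yes qy = ⊥-elim (P⊥Q (py , qy))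
... | yes _  | yes _  | no _   = cong suc ih
... | yes _  | no _   | yes _  = trans (cong suc ih) (sym (+-suc _ _))
... | yes ry | no ¬py | no ¬qy = ⊥-elim ([ ¬py , ¬qy ]′ (R⊆P∪Q ry))
... | no ¬ry | yes py | _      = contradiction (P∪Q⊆R (inj₁ py)) ¬ry
... | no ¬ry | no _   | yes qy = contradiction (P∪Q⊆R (inj₂ qy)) ¬ry
... | no _   | no _   | no _   = ih

module Position {X : Set a} (_≟ₓ_ : DecidableEquality X) where

  indexOf : X → List X → Maybe ℕ
  indexOf x []       = nothing
  indexOf x (y ∷ ys) with x ≟ₓ y
  ... | yes _ = just 0
  ... | no  _ = Maybe.map suc (indexOf x ys)

  indexOf-∉ : ∀ {x ys} → x ∉ ys → indexOf x ys ≡ nothing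
  indexOf-∉ {ys = []}         _  = refl
  indexOf-∉ {x} {ys = y ∷ ys} x∉ with x ≟ₓ y
  ... | yes x≡y = contradiction (here x≡y) x∉
  ... | no  _   = cong (Maybe.map suc) (indexOf-∉ (λ x∈ → x∉ (there x∈)))

  indexOf-++ˡ : ∀ {x} ys {zs i} → indexOf x ys ≡ just i → indexOf x (ys ++ zs) ≡ just i
  indexOf-++ˡ {x} (y ∷ ys) {zs} found with x ≟ₓ y
  ... | yes _ = found
  ... | no  _ with indexOf x ys in eq
  ...   | just _ rewrite indexOf-++ˡ ys {zs} eq = found
  indexOf-++ˡ (y ∷ ys) () | no _ | nothing

  indexOf-++ʳ : ∀ {x} ys {zs} → x ∉ ys →
                indexOf x (ys ++ zs) ≡ Maybe.map (length ys +_) (indexOf x zs)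
  indexOf-++ʳ []                   _  = sym (map-id _)
  indexOf-++ʳ {x} (y ∷ ys) {zs} x∉ with x ≟ₓ y
  ... | yes x≡y = contradiction (here x≡y) x∉
  ... | no  _   = trans (cong (Maybe.map suc) (indexOf-++ʳ ys (λ x∈ → x∉ (there x∈))))
                        (sym (map-∘ᵐ (indexOf x zs)))

  indexOf-unique : ∀ {x ys} → x ∈ ys → (∀ {y} → y ∈ ys → y ≡ x) → indexOf x ys ≡ just 0
  indexOf-unique {x} {y ∷ ys} _ only-x with x ≟ₓ y
  ... | yes _   = refl
  ... | no  x≢y = contradiction (sym (only-x (here refl))) x≢y

-- RTopK k A i j is, by definition, levelsBelow k for rank = rankIn A i j on range i j.
module Levels {X : Set a} (_≟ₓ_ : DecidableEquality X) (rank : X → ℕ) (xs : List X) where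

  open Position _≟ₓ_

  level : ℕ → List X
  level m = filter (λ x → rank x ≟ m) xs

  levelsBelow : ℕ → List X
  levelsBelow k = concatMap level (upTo k)

  #rankBelow : ℕ → ℕ
  #rankBelow k = count (λ x → rank x <? k) xs

  UniqueRank : X → Set a
  UniqueRank x = ∀ {y} → y ∈ xs → rank y ≡ rank x → y ≡ x

  levelsBelow-suc : ∀ k → levelsBelow (suc k) ≡ levelsBelow k ++ level k
  levelsBelow-suc k = begin
    concatMap level (upTo (suc k))  ≡⟨ cong (concatMap level) (upTo-∷ʳ k) ⟨
    concatMap level (upTo k ∷ʳ k)   ≡⟨ concatMap-++ level (upTo k) [ k ] ⟩
    levelsBelow k ++ level k ++ []  ≡⟨ cong (levelsBelow k ++_) (++-identityʳ (level k)) ⟩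
    levelsBelow k ++ level k        ∎

  rank<-∈levelsBelow : ∀ {k x} → x ∈ levelsBelow k → rank x < k
  rank<-∈levelsBelow {k} x∈ with find (∈-concatMap⁻ level {xs = upTo k} x∈)
  ... | m , m∈ , x∈level with ∈-applyUpTo⁻ id m∈ | ∈-filter⁻ (λ x → rank x ≟ m) {xs = xs} x∈level
  ...   | _ , m<k , refl | _ , refl = m<k

  #rankBelow-suc : ∀ k → #rankBelow (suc k) ≡ #rankBelow k + count (λ x → rank x ≟ k) xs
  #rankBelow-suc k = count-disjoint-∪ (λ x → rank x <? k) (λ x → rank x ≟ k) (λ x → rank x <? suc k)
    (m<1+n⇒m<n∨m≡n , [ m<n⇒m<1+n , (λ r≡k → ≤-reflexive (cong suc r≡k)) ]′)
    (λ (r<k , r≡k) → <-irrefl r≡k r<k)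
    xs

  length-levelsBelow : ∀ k → length (levelsBelow k) ≡ #rankBelow k
  length-levelsBelow zero =
    sym (cong length (filter-none (λ x → rank x <? 0) (All.universal (λ _ → n≮0) xs)))
  length-levelsBelow (suc k) = begin
    length (levelsBelow (suc k))                   ≡⟨ cong length (levelsBelow-suc k) ⟩
    length (levelsBelow k ++ level k)              ≡⟨ length-++ (levelsBelow k) ⟩
    length (levelsBelow k) + length (level k)      ≡⟨ cong (_+ length (level k)) (length-levelsBelow k) ⟩
    #rankBelow k + count (λ x → rank x ≟ k) xs     ≡⟨ #rankBelow-suc k ⟨
    #rankBelow (suc k)                             ∎

  indexOf-level : ∀ {x} → x ∈ xs → UniqueRank x → indexOf x (level (rank x)) ≡ just 0
  indexOf-level {x} x∈ unique = indexOf-unique (∈-filter⁺ (λ y → rank y ≟ rank x) x∈ refl) only-x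
    where
    only-x : ∀ {y} → y ∈ level (rank x) → y ≡ x
    only-x y∈ = let y∈xs , same-rank = ∈-filter⁻ (λ y → rank y ≟ rank x) {xs = xs} y∈
                in unique y∈xs same-rank

  indexOf-levelsBelow-≥ : ∀ {k x} → k ≤ rank x → indexOf x (levelsBelow k) ≡ nothing
  indexOf-levelsBelow-≥ k≤r = indexOf-∉ (λ x∈ → <⇒≱ (rank<-∈levelsBelow x∈) k≤r)

  indexOf-levelsBelow-< : ∀ {k x} → x ∈ xs → UniqueRank x → rank x < k →
                          indexOf x (levelsBelow k) ≡ just (#rankBelow (rank x))
  indexOf-levelsBelow-< {suc k} {x} x∈ unique r<1+k rewrite levelsBelow-suc k
    with m<1+n⇒m<n∨m≡n r<1+k
  ... | inj₁ r<k  = indexOf-++ˡ (levelsBelow k) (indexOf-levelsBelow-< x∈ unique r<k)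
  ... | inj₂ refl = begin
    indexOf x (levelsBelow (rank x) ++ level (rank x))
      ≡⟨ indexOf-++ʳ (levelsBelow (rank x)) (λ x∈′ → <-irrefl refl (rank<-∈levelsBelow x∈′)) ⟩
    Maybe.map (length (levelsBelow (rank x)) +_) (indexOf x (level (rank x)))
      ≡⟨ cong (Maybe.map _) (indexOf-level x∈ unique) ⟩
    just (length (levelsBelow (rank x)) + 0)
      ≡⟨ cong just (trans (+-identityʳ _) (length-levelsBelow (rank x))) ⟩
    just (#rankBelow (rank x))
      ∎

  fromMaybe-indexOf-levelsBelow : ∀ k {x} → x ∈ xs → UniqueRank x → #rankBelow (rank x) ≡ rank x →
                                  fromMaybe k (indexOf x (levelsBelow k)) ≡ rank x ⊓ k
  fromMaybe-indexOf-levelsBelow k {x} x∈ unique dense with rank x <? k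
  ... | yes r<k = begin
    fromMaybe k (indexOf x (levelsBelow k))  ≡⟨ cong (fromMaybe k) (indexOf-levelsBelow-< x∈ unique r<k) ⟩
    #rankBelow (rank x)                      ≡⟨ dense ⟩
    rank x                                   ≡⟨ m≤n⇒m⊓n≡m (<⇒≤ r<k) ⟨
    rank x ⊓ k                               ∎
  ... | no r≮k = trans (cong (fromMaybe k) (indexOf-levelsBelow-≥ (≮⇒≥ r≮k)))
                       (sym (m≥n⇒m⊓n≡n (≮⇒≥ r≮k)))

∈-range⁻ : ∀ {i j p} → p ∈ range i j → i ≤ p × p ≤ j
∈-range⁻ {i} {j} p∈ with ∈-map⁻ (i +_) p∈
... | m , m∈ , refl with ∈-applyUpTo⁻ id m∈
...   | _ , m<1+j∸i , refl = m≤m+n i m , subst (_≤ j) (+-comm m i) (≤-pred 1+m+i≤1+j)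
  where
  i<1+j : i < suc j
  i<1+j = m∸n≢0⇒n<m (λ 1+j∸i≡0 → n≮0 (subst (m <_) 1+j∸i≡0 m<1+j∸i))
  1+m+i≤1+j : suc m + i ≤ suc j
  1+m+i≤1+j = m≤o∸n⇒m+n≤o (suc m) (<⇒≤ i<1+j) m<1+j∸i

range-∷ : ∀ {i j} → i ≤ j → range i j ≡ i ∷ range (suc i) j
range-∷ {i} {j} i≤j = begin
  map (i +_) (upTo (suc j ∸ i))
    ≡⟨ cong (λ m → map (i +_) (upTo m)) (+-∸-assoc 1 i≤j) ⟩
  map (i +_) (upTo (suc (j ∸ i)))
    ≡⟨ cong (λ ms → i + 0 ∷ map (i +_) ms) (map-applyUpTo id suc (j ∸ i)) ⟨
  i + 0 ∷ map (i +_) (map suc (upTo (j ∸ i)))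
    ≡⟨ cong₂ _∷_ (+-identityʳ i) (sym (map-∘ (upTo (j ∸ i)))) ⟩
  i ∷ map (λ m → i + suc m) (upTo (j ∸ i))
    ≡⟨ cong (i ∷_) (map-cong (+-suc i) (upTo (j ∸ i))) ⟩
  i ∷ range (suc i) j
    ∎

module Window (A : Array) (i j : ℕ) where

  rank : ℕ → ℕ
  rank = rankIn A i j

  rank-anti : ∀ {p q} → q ∈ range i j → A p <ℤ A q → rank q < rank p
  rank-anti {p} {q} q∈ Ap<Aq = count-strict-mono (λ y → A q ℤ.<? A y) (λ y → A p ℤ.<? A y)
    (λ _ → ℤ.<-trans Ap<Aq) q∈ (ℤ.<-irrefl refl) Ap<Aq

  rank-first : i ≤ j → rank i ≡ d A j i
  rank-first i≤j = begin
    count (λ q → A i ℤ.<? A q) (range i j)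
      ≡⟨ cong (count (λ q → A i ℤ.<? A q)) (range-∷ i≤j) ⟩
    count (λ q → A i ℤ.<? A q) (i ∷ range (suc i) j)
      ≡⟨ cong length (filter-reject (λ q → A i ℤ.<? A q) (ℤ.<-irrefl refl)) ⟩
    d A j i
      ∎

  module _ (A-injective : ∀ {p q} → p ∈ range i j → q ∈ range i j → A p ≡ A q → p ≡ q) where

    rank-injective : ∀ {p q} → p ∈ range i j → q ∈ range i j → rank p ≡ rank q → p ≡ q
    rank-injective {p} {q} p∈ q∈ same-rank with ℤ.<-cmp (A p) (A q)
    ... | tri< Ap<Aq _ _ = contradiction (sym same-rank) (<⇒≢ (rank-anti q∈ Ap<Aq))
    ... | tri≈ _ Ap≡Aq _ = A-injective p∈ q∈ Ap≡Aq
    ... | tri> _ _ Aq<Ap = contradiction same-rank (<⇒≢ (rank-anti p∈ Aq<Ap))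

    rank<⇒>ᴬ : ∀ {p q} → p ∈ range i j → q ∈ range i j → rank p < rank q → A q <ℤ A p
    rank<⇒>ᴬ {p} {q} p∈ q∈ rp<rq with ℤ.<-cmp (A p) (A q)
    ... | tri< Ap<Aq _ _ = contradiction (rank-anti q∈ Ap<Aq) (<-asym rp<rq)
    ... | tri≈ _ Ap≡Aq _ = contradiction (cong rank (A-injective p∈ q∈ Ap≡Aq)) (<⇒≢ rp<rq)
    ... | tri> _ _ Aq<Ap = Aq<Ap

    -- The positions of smaller rank than q are exactly those holding a larger value.
    #rankBelow-rank : ∀ {q} → q ∈ range i j → count (λ p → rank p <? rank q) (range i j) ≡ rank q
    #rankBelow-rank {q} q∈ = count-cong (λ p → rank p <? rank q) (λ p → A q ℤ.<? A p)
      (λ p∈ → rank<⇒>ᴬ p∈ q∈) (λ p∈ → rank-anti p∈)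

Distinct⇒injective-on-range : ∀ {n A i j} → Distinct n A → 1 ≤ i → j ≤ n →
  ∀ {p q} → p ∈ range i j → q ∈ range i j → A p ≡ A q → p ≡ q
Distinct⇒injective-on-range distinct 1≤i j≤n {p} {q} p∈ q∈ =
  let i≤p , p≤j = ∈-range⁻ p∈
      i≤q , q≤j = ∈-range⁻ q∈
  in distinct p q (≤-trans 1≤i i≤p) (≤-trans p≤j j≤n) (≤-trans 1≤i i≤q) (≤-trans q≤j j≤n)

RTopK-entry : ∀ {n} k {j ℓ} (A : Array) → Distinct n A → 1 ≤ ℓ → ℓ ≤ j → j ≤ n →
  fromMaybe k (Position.indexOf _≟_ ℓ (RTopK k A ℓ j)) ≡ d A j ℓ ⊓ k
RTopK-entry k {j} {ℓ} A distinct 1≤ℓ ℓ≤j j≤n = begin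
  fromMaybe k (indexOf ℓ (levelsBelow k))
    ≡⟨ fromMaybe-indexOf-levelsBelow k ℓ∈ ℓ-unique (#rankBelow-rank A-inj ℓ∈) ⟩
  rank ℓ ⊓ k
    ≡⟨ cong (_⊓ k) (rank-first ℓ≤j) ⟩
  d A j ℓ ⊓ k
    ∎
  where
  open Window A ℓ j
  open Levels _≟_ rank (range ℓ j)
  open Position _≟_
  A-inj : ∀ {p q} → p ∈ range ℓ j → q ∈ range ℓ j → A p ≡ A q → p ≡ q
  A-inj = Distinct⇒injective-on-range distinct 1≤ℓ j≤n

  ℓ∈ : ℓ ∈ range ℓ j
  ℓ∈ = subst (ℓ ∈_) (sym (range-∷ ℓ≤j)) (here refl)

  ℓ-unique : UniqueRank ℓ
  ℓ-unique y∈ = rank-injective A-inj y∈ ℓ∈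

zipWith-map-diagonal : ∀ {Y Z : Set a} (f : X → Y → Z) (g : X → Y) xs →
                       zipWith f xs (map g xs) ≡ map (λ x → f x (g x)) xs
zipWith-map-diagonal f g []       = refl
zipWith-map-diagonal f g (x ∷ xs) = cong (f x (g x) ∷_) (zipWith-map-diagonal f g xs)

lemma5 : (n k j : ℕ) → 1 ≤ k → 1 ≤ j → j ≤ n →
    Σ (List (List ℕ) → List ℕ) (λ reconstruct →
      (A : Array) → Distinct n A → reconstruct (queries k j A) ≡ S k j A)
lemma5 n k j _ _ j≤n = reconstruct , correct
  where
  open Position _≟_

  entry : ℕ → List ℕ → ℕ
  entry ℓ answer = fromMaybe k (indexOf ℓ answer)

  reconstruct : List (List ℕ) → List ℕ
  reconstruct = zipWith entry (range 1 j)

  correct : (A : Array) → Distinct n A → reconstruct (queries k j A) ≡ S k j A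
  correct A distinct = begin
    zipWith entry (range 1 j) (map (λ ℓ → RTopK k A ℓ j) (range 1 j))
      ≡⟨ zipWith-map-diagonal entry (λ ℓ → RTopK k A ℓ j) (range 1 j) ⟩
    map (λ ℓ → entry ℓ (RTopK k A ℓ j)) (range 1 j)
      ≡⟨ map-cong-local (All.tabulate (λ ℓ∈ → let 1≤ℓ , ℓ≤j = ∈-range⁻ ℓ∈
                                              in RTopK-entry k A distinct 1≤ℓ ℓ≤j j≤n)) ⟩
    S k j A
      ∎
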